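{- Let $k \ge s \ge 0$ be integers. For a path chosen uniformly at random among the $\binom{k+s}{s}$ paths with $k$ upsteps and $s$ downsteps, the expected number of visits to $-1$ from above is \[ \frac{1}{\binom{k+s}{s}} \sum_{r=0}^{s-1} \binom{k+s}{r}. \]
   Context: A path is a finite sequence of steps, each $+1$ (upstep) or $-1$ (downstep), starting at height $0$. A path visits $m$ from above at time $r$ if its height after $r$ steps is $m$ and its $r$-th step is a downstep. -}

module Defs where

open import Data.Nat using (ℕ; zero; suc; _+_; _≤_; _<_; s≤s; z≤n; NonZero; >-nonZero)
open import Data.Nat.Properties using (≤-trans; m≤m+n; +-suc; +-comm)
open import Data.Nat.Combinatorics using (_C_; nCn≡1; nCk≡nC[n∸k]; nCk+nC[k+1]≡[n+1]C[k+1])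
open import Data.Integer as ℤ using (ℤ; +_; -[1+_])
open import Data.Integer.Properties using () renaming (_≟_ to _≟ℤ_)
open import Data.List using (List; []; _∷_; map; _++_; length; upTo)
open import Data.Nat.ListAction using (sum)
open import Data.Rational using (ℚ; 0ℚ; _/_)
open import Relation.Nullary using (yes; no)
open import Relation.Binary.PropositionalEquality using (_≡_; refl; subst; sym; trans; cong)

data Step : Set where
  up   : Step
  down : Step

Path : Set
Path = List Step

val : Step → ℤ
val up   = + 1
val down = -[1+ 0 ]

visitsFromAt : ℤ → ℤ → Path → ℕ
visitsFromAt m h []         = 0
visitsFromAt m h (up ∷ p)   = visitsFromAt m (h ℤ.+ + 1) p
visitsFromAt m h (down ∷ p) with (h ℤ.- + 1) ≟ℤ m
... | yes _ = suc (visitsFromAt m (h ℤ.- + 1) p)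
... | no  _ = visitsFromAt m (h ℤ.- + 1) p

visitsFromAbove : ℤ → Path → ℕ
visitsFromAbove m p = visitsFromAt m (+ 0) p

-- The list of ALL paths with exactly k upsteps and s downsteps
-- (each occurring exactly once).
paths : ℕ → ℕ → List Path
paths zero    zero    = [] ∷ []
paths (suc k) zero    = map (up ∷_) (paths k zero)
paths zero    (suc s) = map (down ∷_) (paths zero s)
paths (suc k) (suc s) = map (up ∷_) (paths k (suc s)) ++ map (down ∷_) (paths (suc k) s)

-- Expectation of f under the uniform distribution on a finite list
-- (the empty list is given expectation 0; it never arises below).
uniformExpectation : {A : Set} → (A → ℕ) → List A → ℚ
uniformExpectation f []       = 0ℚ
uniformExpectation f (x ∷ xs) = (+ sum (map f (x ∷ xs))) / suc (length xs)

sumBelow : ℕ → (ℕ → ℕ) → ℕ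
sumBelow n g = sum (map g (upTo n))

C-pos : ∀ n k → k ≤ n → 0 < n C k
C-pos n zero _ = subst (0 <_) (sym (C0 n)) (s≤s z≤n)
  where
  C0 : ∀ n → n C 0 ≡ 1
  C0 n = trans (nCk≡nC[n∸k] {0} {n} z≤n) (nCn≡1 n)
C-pos (suc n) (suc k) (s≤s k≤n) =
  subst (0 <_) (nCk+nC[k+1]≡[n+1]C[k+1] n k) (≤-trans (C-pos n k k≤n) (m≤m+n (n C k) (n C suc k)))

C-nonZero : ∀ k s → NonZero ((k + s) C s)
C-nonZero k s = >-nonZero (C-pos (k + s) s (subst (s ≤_) (+-comm s k) (m≤m+n s k)))

module Submission where

-- Let T(k,s) be the total number of visits to -1 from above,
-- summed over all paths with k upsteps and s downsteps; the expectation is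
-- T(k,s) divided by the number C(k+s,s) of such paths.  Every such path
-- ends either with an upstep (which adds no visit) or with a downstep,
-- which adds one visit exactly when the path before it is at height 0,
-- i.e. when the shorter path has equally many up- and downsteps.  Sorting
-- paths by their LAST step therefore gives the Pascal-type recurrence
--   T(k+1,s+1) = T(k,s+1) + T(k+1,s) + [s = k+1]·C(2k+2,k+1),
-- and the partial row sums R(n,m) = Σ_{r<m} C(n,r) satisfy the matching
-- recurrence R(n+1,m+1) = R(n,m+1) + R(n,m).  Induction yields
-- T(k,s) = R(k+s, min(s,k+1)) for all k, s, which is R(k+s,s) when s ≤ k.

open import Defs
open import Data.Nat using (ℕ; zero; suc; _≤_; _+_; _*_; _⊓_; s≤s; z≤n; NonZero)
import Data.Nat.Properties as ℕP
open import Algebra.Properties.CommutativeSemigroup ℕP.+-commutativeSemigroup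
  using (interchange; xy∙z≈xz∙y; x∙yz≈y∙xz)
open import Data.Nat.Base using (≢-nonZero⁻¹)
open import Data.Nat.Combinatorics using (_C_; nCn≡1; nCk+nC[k+1]≡[n+1]C[k+1])
open import Data.Nat.ListAction using (sum)
open import Data.Nat.ListAction.Properties using (sum-++)
open import Data.Integer as ℤ using (ℤ; +_; -[1+_]; _⊖_; 0ℤ)
import Data.Integer.Properties as ℤP
open import Data.Integer.Properties using () renaming (_≟_ to _≟ℤ_)
open import Data.Rational using (_/_)
open import Data.List using (List; []; _∷_; _∷ʳ_; map; _++_; length; upTo)
open import Data.List.Properties using (map-++; length-++; length-map; map-∘; map-cong; upTo-∷ʳ)
open import Data.List.Relation.Unary.All as All using (All; []; _∷_)
open import Data.List.Relation.Unary.All.Properties using (map⁺; ++⁺)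
open import Data.Empty using (⊥-elim)
open import Relation.Nullary using (yes; no)
open import Relation.Binary using (tri<; tri≈; tri>)
open import Relation.Binary.PropositionalEquality
open import Function using (_∘_)

height : Path → ℤ
height []      = + 0
height (x ∷ p) = val x ℤ.+ height p

hit : ℤ → ℤ → ℕ
hit m g with (g ℤ.- + 1) ≟ℤ m
... | yes _ = 1
... | no  _ = 0

stepVisit : ℤ → Step → ℤ → ℕ
stepVisit m up   g = 0
stepVisit m down g = hit m g

visits-∷ : ∀ m h x q → visitsFromAt m h (x ∷ q) ≡ stepVisit m x h + visitsFromAt m (h ℤ.+ val x) q
visits-∷ m h up   q = refl
visits-∷ m h down q with (h ℤ.- + 1) ≟ℤ m
... | yes _ = refl
... | no  _ = refl

visits-∷ʳ : ∀ m h p x →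
  visitsFromAt m h (p ∷ʳ x) ≡ visitsFromAt m h p + stepVisit m x (h ℤ.+ height p)
visits-∷ʳ m h [] x = begin
  visitsFromAt m h (x ∷ [])    ≡⟨ visits-∷ m h x [] ⟩
  stepVisit m x h + 0          ≡⟨ ℕP.+-identityʳ _ ⟩
  stepVisit m x h              ≡⟨ cong (stepVisit m x) (sym (ℤP.+-identityʳ h)) ⟩
  stepVisit m x (h ℤ.+ + 0)    ∎
  where open ≡-Reasoning
visits-∷ʳ m h (y ∷ p) x = begin
  visitsFromAt m h (y ∷ p ∷ʳ x)
    ≡⟨ visits-∷ m h y (p ∷ʳ x) ⟩
  a + visitsFromAt m h′ (p ∷ʳ x)
    ≡⟨ cong (λ n → a + n) (visits-∷ʳ m h′ p x) ⟩
  a + (visitsFromAt m h′ p + stepVisit m x (h′ ℤ.+ height p))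
    ≡⟨ sym (ℕP.+-assoc a _ _) ⟩
  (a + visitsFromAt m h′ p) + stepVisit m x (h′ ℤ.+ height p)
    ≡⟨ cong₂ _+_ (sym (visits-∷ m h y p)) (cong (stepVisit m x) (ℤP.+-assoc h (val y) (height p))) ⟩
  visitsFromAt m h (y ∷ p) + stepVisit m x (h ℤ.+ height (y ∷ p)) ∎
  where
  open ≡-Reasoning
  a  = stepVisit m y h
  h′ = h ℤ.+ val y

pathSum : ℕ → ℕ → (Path → ℕ) → ℕ
pathSum k s f = sum (map f (paths k s))

pathSum-cong : ∀ k s {f g : Path → ℕ} → (∀ p → f p ≡ g p) → pathSum k s f ≡ pathSum k s g
pathSum-cong k s f≗g = cong sum (map-cong f≗g (paths k s))

sum-map-prefix : ∀ (f : Path → ℕ) x (ps : List Path) →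
  sum (map f (map (x ∷_) ps)) ≡ sum (map (f ∘ (x ∷_)) ps)
sum-map-prefix f x ps = cong sum (sym (map-∘ ps))

pathSum-ups : ∀ k f → pathSum (suc k) 0 f ≡ pathSum k 0 (f ∘ (up ∷_))
pathSum-ups k f = sum-map-prefix f up (paths k 0)

pathSum-downs : ∀ s f → pathSum 0 (suc s) f ≡ pathSum 0 s (f ∘ (down ∷_))
pathSum-downs s f = sum-map-prefix f down (paths 0 s)

pathSum-first : ∀ k s f →
  pathSum (suc k) (suc s) f ≡ pathSum k (suc s) (f ∘ (up ∷_)) + pathSum (suc k) s (f ∘ (down ∷_))
pathSum-first k s f = begin
  sum (map f (ups ++ downs))           ≡⟨ cong sum (map-++ f ups downs) ⟩
  sum (map f ups ++ map f downs)       ≡⟨ sum-++ (map f ups) (map f downs) ⟩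
  sum (map f ups) + sum (map f downs)  ≡⟨ cong₂ _+_ (sum-map-prefix f up (paths k (suc s)))
                                                    (sum-map-prefix f down (paths (suc k) s)) ⟩
  pathSum k (suc s) (f ∘ (up ∷_)) + pathSum (suc k) s (f ∘ (down ∷_)) ∎
  where
  open ≡-Reasoning
  ups   = map (up ∷_) (paths k (suc s))
  downs = map (down ∷_) (paths (suc k) s)

pathSum-ups-last : ∀ k f → pathSum (suc k) 0 f ≡ pathSum k 0 (f ∘ (_∷ʳ up))
pathSum-ups-last zero    f = refl
pathSum-ups-last (suc k) f =
  trans (pathSum-ups (suc k) f)
    (trans (pathSum-ups-last k (f ∘ (up ∷_))) (sym (pathSum-ups k (f ∘ (_∷ʳ up)))))

pathSum-downs-last : ∀ s f → pathSum 0 (suc s) f ≡ pathSum 0 s (f ∘ (_∷ʳ down))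
pathSum-downs-last zero    f = refl
pathSum-downs-last (suc s) f =
  trans (pathSum-downs (suc s) f)
    (trans (pathSum-downs-last s (f ∘ (down ∷_))) (sym (pathSum-downs s (f ∘ (_∷ʳ down)))))

pathSum-last : ∀ k s f →
  pathSum (suc k) (suc s) f ≡ pathSum k (suc s) (f ∘ (_∷ʳ up)) + pathSum (suc k) s (f ∘ (_∷ʳ down))
pathSum-last zero zero f =   -- the two paths up·down and down·up, in swapped order
  trans (ℕP.+-comm (f (up ∷ down ∷ [])) _) (cong (λ n → f (down ∷ up ∷ []) + 0 + n) (sym (ℕP.+-identityʳ _)))
pathSum-last (suc k) zero f = begin
  pathSum (suc (suc k)) 1 f
    ≡⟨ pathSum-first (suc k) 0 f ⟩
  pathSum (suc k) 1 (f ∘ (up ∷_)) + pathSum (suc (suc k)) 0 (f ∘ (down ∷_))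
    ≡⟨ cong₂ _+_ (pathSum-last k 0 (f ∘ (up ∷_))) (pathSum-ups-last (suc k) (f ∘ (down ∷_))) ⟩
  (a + b) + c
    ≡⟨ xy∙z≈xz∙y a b c ⟩
  (a + c) + b
    ≡⟨ cong₂ _+_ (sym (pathSum-first k 0 (f ∘ (_∷ʳ up)))) (sym (pathSum-ups (suc k) (f ∘ (_∷ʳ down)))) ⟩
  pathSum (suc k) 1 (f ∘ (_∷ʳ up)) + pathSum (suc (suc k)) 0 (f ∘ (_∷ʳ down)) ∎
  where
  open ≡-Reasoning
  a = pathSum k 1 (f ∘ (up ∷_) ∘ (_∷ʳ up))
  b = pathSum (suc k) 0 (f ∘ (up ∷_) ∘ (_∷ʳ down))
  c = pathSum (suc k) 0 (f ∘ (down ∷_) ∘ (_∷ʳ up))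
pathSum-last zero (suc s) f = begin
  pathSum 1 (suc (suc s)) f
    ≡⟨ pathSum-first 0 (suc s) f ⟩
  pathSum 0 (suc (suc s)) (f ∘ (up ∷_)) + pathSum 1 (suc s) (f ∘ (down ∷_))
    ≡⟨ cong₂ _+_ (pathSum-downs-last (suc s) (f ∘ (up ∷_))) (pathSum-last 0 s (f ∘ (down ∷_))) ⟩
  b + (a + d)
    ≡⟨ x∙yz≈y∙xz b a d ⟩
  a + (b + d)
    ≡⟨ cong₂ _+_ (sym (pathSum-downs (suc s) (f ∘ (_∷ʳ up)))) (sym (pathSum-first 0 s (f ∘ (_∷ʳ down)))) ⟩
  pathSum 0 (suc (suc s)) (f ∘ (_∷ʳ up)) + pathSum 1 (suc s) (f ∘ (_∷ʳ down)) ∎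
  where
  open ≡-Reasoning
  a = pathSum 0 (suc s) (f ∘ (down ∷_) ∘ (_∷ʳ up))
  b = pathSum 0 (suc s) (f ∘ (up ∷_) ∘ (_∷ʳ down))
  d = pathSum 1 s (f ∘ (down ∷_) ∘ (_∷ʳ down))
pathSum-last (suc k) (suc s) f = begin
  pathSum (suc (suc k)) (suc (suc s)) f
    ≡⟨ pathSum-first (suc k) (suc s) f ⟩
  pathSum (suc k) (suc (suc s)) (f ∘ (up ∷_)) + pathSum (suc (suc k)) (suc s) (f ∘ (down ∷_))
    ≡⟨ cong₂ _+_ (pathSum-last k (suc s) (f ∘ (up ∷_))) (pathSum-last (suc k) s (f ∘ (down ∷_))) ⟩
  (a + b) + (c + d)
    ≡⟨ interchange a b c d ⟩
  (a + c) + (b + d)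
    ≡⟨ cong₂ _+_ (sym (pathSum-first k (suc s) (f ∘ (_∷ʳ up))))
                 (sym (pathSum-first (suc k) s (f ∘ (_∷ʳ down)))) ⟩
  pathSum (suc k) (suc (suc s)) (f ∘ (_∷ʳ up)) + pathSum (suc (suc k)) (suc s) (f ∘ (_∷ʳ down)) ∎
  where
  open ≡-Reasoning
  a = pathSum k (suc (suc s)) (f ∘ (up ∷_) ∘ (_∷ʳ up))
  b = pathSum (suc k) (suc s) (f ∘ (up ∷_) ∘ (_∷ʳ down))
  c = pathSum (suc k) (suc s) (f ∘ (down ∷_) ∘ (_∷ʳ up))
  d = pathSum (suc (suc k)) s (f ∘ (down ∷_) ∘ (_∷ʳ down))

length-paths : ∀ k s → length (paths k s) ≡ (k + s) C s
length-paths zero zero = refl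
length-paths (suc k) zero = trans (length-map _ (paths k 0)) (length-paths k 0)
length-paths zero (suc s) =
  trans (length-map _ (paths 0 s)) (trans (length-paths 0 s) (trans (nCn≡1 s) (sym (nCn≡1 (suc s)))))
length-paths (suc k) (suc s) = begin
  length (map (up ∷_) (paths k (suc s)) ++ map (down ∷_) (paths (suc k) s))
    ≡⟨ length-++ (map (up ∷_) (paths k (suc s))) ⟩
  length (map (up ∷_) (paths k (suc s))) + length (map (down ∷_) (paths (suc k) s))
    ≡⟨ cong₂ _+_ (length-map _ (paths k (suc s))) (length-map _ (paths (suc k) s)) ⟩
  length (paths k (suc s)) + length (paths (suc k) s)
    ≡⟨ cong₂ _+_ (length-paths k (suc s)) (length-paths (suc k) s) ⟩
  (k + suc s) C suc s + n C s
    ≡⟨ cong (λ m → m C suc s + n C s) (ℕP.+-suc k s) ⟩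
  n C suc s + n C s
    ≡⟨ ℕP.+-comm (n C suc s) (n C s) ⟩
  n C s + n C suc s
    ≡⟨ nCk+nC[k+1]≡[n+1]C[k+1] n s ⟩
  suc n C suc s
    ≡⟨ cong (λ m → suc m C suc s) (sym (ℕP.+-suc k s)) ⟩
  (suc k + suc s) C suc s ∎
  where
  open ≡-Reasoning
  n = suc (k + s)

height-up : ∀ k s {p} → height p ≡ k ⊖ s → height (up ∷ p) ≡ suc k ⊖ s
height-up k s eq = trans (cong (λ g → + 1 ℤ.+ g) eq) (ℤP.distribʳ-⊖-+-pos 1 k s)

height-down : ∀ k s {p} → height p ≡ k ⊖ s → height (down ∷ p) ≡ k ⊖ suc s
height-down k s eq = trans (cong (λ g → -[1+ 0 ] ℤ.+ g) eq) (ℤP.distribʳ-⊖-+-neg 0 k s)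

height-paths : ∀ k s → All (λ p → height p ≡ k ⊖ s) (paths k s)
height-paths zero    zero    = refl ∷ []
height-paths (suc k) zero    = map⁺ (All.map (λ {p} → height-up k 0 {p}) (height-paths k 0))
height-paths zero    (suc s) = map⁺ (All.map (λ {p} → height-down 0 s {p}) (height-paths 0 s))
height-paths (suc k) (suc s) =
  ++⁺ (map⁺ (All.map (λ {p} → height-up k (suc s) {p}) (height-paths k (suc s))))
      (map⁺ (All.map (λ {p} → height-down (suc k) s {p}) (height-paths (suc k) s)))

sum-map-const : ∀ {A : Set} (f : A → ℕ) c {xs : List A} →
  All (λ x → f x ≡ c) xs → sum (map f xs) ≡ length xs * c
sum-map-const f c []         = refl
sum-map-const f c (fx≡c ∷ all) = cong₂ _+_ fx≡c (sum-map-const f c all)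

pathSum-height : ∀ k s (g : ℤ → ℕ) → pathSum k s (g ∘ height) ≡ length (paths k s) * g (k ⊖ s)
pathSum-height k s g = sum-map-const (g ∘ height) (g (k ⊖ s)) (All.map (cong g) (height-paths k s))

sum-map-+ : ∀ {A : Set} (f g : A → ℕ) (xs : List A) →
  sum (map (λ x → f x + g x) xs) ≡ sum (map f xs) + sum (map g xs)
sum-map-+ f g []       = refl
sum-map-+ f g (x ∷ xs) =
  trans (cong (λ n → f x + g x + n) (sum-map-+ f g xs)) (interchange (f x) (g x) _ _)

hit-from-≢0 : ∀ g → g ≢ 0ℤ → hit -[1+ 0 ] g ≡ 0
hit-from-≢0 g g≢0 with (g ℤ.- + 1) ≟ℤ -[1+ 0 ]
... | no  _      = refl
... | yes g-1≡-1 = ⊥-elim (g≢0 (begin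
  g                            ≡⟨ sym (ℤP.+-identityʳ g) ⟩
  g ℤ.+ (-[1+ 0 ] ℤ.+ + 1)     ≡⟨ sym (ℤP.+-assoc g -[1+ 0 ] (+ 1)) ⟩
  (g ℤ.- + 1) ℤ.+ + 1          ≡⟨ cong (λ h → h ℤ.+ + 1) g-1≡-1 ⟩
  0ℤ                           ∎))
  where open ≡-Reasoning

visitTotal : ℕ → ℕ → ℕ
visitTotal k s = pathSum k s (visitsFromAbove -[1+ 0 ])

-- Visits created by appending a downstep to each path with k upsteps and
-- s downsteps.  These paths all end at height k - s, so this is their
-- number when k = s and 0 otherwise.
crossings : ℕ → ℕ → ℕ
crossings k s = length (paths k s) * hit -[1+ 0 ] (k ⊖ s)

crossings-diag : ∀ k → crossings k k ≡ (k + k) C k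
crossings-diag k = begin
  length (paths k k) * hit -[1+ 0 ] (k ⊖ k)  ≡⟨ cong₂ _*_ (length-paths k k) (cong (hit -[1+ 0 ]) (ℤP.n⊖n≡0 k)) ⟩
  ((k + k) C k) * 1                          ≡⟨ ℕP.*-identityʳ ((k + k) C k) ⟩
  (k + k) C k                                ∎
  where open ≡-Reasoning

crossings-off : ∀ k s → s ≢ k → crossings k s ≡ 0
crossings-off k s s≢k = trans (cong (length (paths k s) *_) (hit-from-≢0 (k ⊖ s) k⊖s≢0)) (ℕP.*-zeroʳ (length (paths k s)))
  where
  k⊖s≢0 : k ⊖ s ≢ 0ℤ
  k⊖s≢0 eq = s≢k (sym (ℤP.+-injective (ℤP.i-j≡0⇒i≡j (+ k) (+ s) (trans (ℤP.[+m]-[+n]≡m⊖n k s) eq))))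

visitTotal-∷ʳ-up : ∀ k s → pathSum k s (visitsFromAbove -[1+ 0 ] ∘ (_∷ʳ up)) ≡ visitTotal k s
visitTotal-∷ʳ-up k s =
  pathSum-cong k s (λ p → trans (visits-∷ʳ -[1+ 0 ] (+ 0) p up) (ℕP.+-identityʳ _))

visitTotal-∷ʳ-down : ∀ k s →
  pathSum k s (visitsFromAbove -[1+ 0 ] ∘ (_∷ʳ down)) ≡ visitTotal k s + crossings k s
visitTotal-∷ʳ-down k s = begin
  pathSum k s (V ∘ (_∷ʳ down))
    ≡⟨ pathSum-cong k s (λ p → trans (visits-∷ʳ -[1+ 0 ] (+ 0) p down)
                                     (cong (λ g → V p + hit -[1+ 0 ] g) (ℤP.+-identityˡ (height p)))) ⟩
  pathSum k s (λ p → V p + hit -[1+ 0 ] (height p))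
    ≡⟨ sum-map-+ V (hit -[1+ 0 ] ∘ height) (paths k s) ⟩
  visitTotal k s + pathSum k s (hit -[1+ 0 ] ∘ height)
    ≡⟨ cong (λ n → visitTotal k s + n) (pathSum-height k s (hit -[1+ 0 ])) ⟩
  visitTotal k s + crossings k s ∎
  where
  open ≡-Reasoning
  V = visitsFromAbove -[1+ 0 ]

visitTotal-no-downs : ∀ k → visitTotal k 0 ≡ 0
visitTotal-no-downs zero    = refl
visitTotal-no-downs (suc k) =
  trans (pathSum-ups-last k (visitsFromAbove -[1+ 0 ]))
        (trans (visitTotal-∷ʳ-up k 0) (visitTotal-no-downs k))

visitTotal-only-downs : ∀ s → visitTotal 0 (suc s) ≡ 1
visitTotal-only-downs zero    = refl
visitTotal-only-downs (suc s) = begin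
  visitTotal 0 (suc (suc s))
    ≡⟨ pathSum-downs-last (suc s) (visitsFromAbove -[1+ 0 ]) ⟩
  pathSum 0 (suc s) (visitsFromAbove -[1+ 0 ] ∘ (_∷ʳ down))
    ≡⟨ visitTotal-∷ʳ-down 0 (suc s) ⟩
  visitTotal 0 (suc s) + crossings 0 (suc s)
    ≡⟨ cong₂ _+_ (visitTotal-only-downs s) (crossings-off 0 (suc s) (λ ())) ⟩
  1 ∎
  where open ≡-Reasoning

visitTotal-step : ∀ k s →
  visitTotal (suc k) (suc s) ≡ visitTotal k (suc s) + (visitTotal (suc k) s + crossings (suc k) s)
visitTotal-step k s =
  trans (pathSum-last k s (visitsFromAbove -[1+ 0 ]))
        (cong₂ _+_ (visitTotal-∷ʳ-up k (suc s)) (visitTotal-∷ʳ-down (suc k) s))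

rowSum : ℕ → ℕ → ℕ
rowSum n m = sumBelow m (n C_)

sumBelow-suc : ∀ (g : ℕ → ℕ) m → sumBelow (suc m) g ≡ sumBelow m g + g m
sumBelow-suc g m = begin
  sum (map g (upTo (suc m)))             ≡⟨ cong (sum ∘ map g) (sym (upTo-∷ʳ m)) ⟩
  sum (map g (upTo m ++ m ∷ []))         ≡⟨ cong sum (map-++ g (upTo m) (m ∷ [])) ⟩
  sum (map g (upTo m) ++ g m ∷ [])       ≡⟨ sum-++ (map g (upTo m)) (g m ∷ []) ⟩
  sumBelow m g + (g m + 0)               ≡⟨ cong (λ n → sumBelow m g + n) (ℕP.+-identityʳ (g m)) ⟩
  sumBelow m g + g m                     ∎
  where open ≡-Reasoning

rowSum-pascal : ∀ n m → rowSum (suc n) (suc m) ≡ rowSum n (suc m) + rowSum n m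
rowSum-pascal n zero    = refl
rowSum-pascal n (suc m) = begin
  rowSum (suc n) (suc (suc m))
    ≡⟨ sumBelow-suc (suc n C_) (suc m) ⟩
  rowSum (suc n) (suc m) + suc n C suc m
    ≡⟨ cong₂ _+_ (rowSum-pascal n m) (sym (nCk+nC[k+1]≡[n+1]C[k+1] n m)) ⟩
  (rowSum n (suc m) + rowSum n m) + (n C m + n C suc m)
    ≡⟨ cong (λ x → rowSum n (suc m) + rowSum n m + x) (ℕP.+-comm (n C m) (n C suc m)) ⟩
  (rowSum n (suc m) + rowSum n m) + (n C suc m + n C m)
    ≡⟨ interchange (rowSum n (suc m)) (rowSum n m) (n C suc m) (n C m) ⟩
  (rowSum n (suc m) + n C suc m) + (rowSum n m + n C m)
    ≡⟨ cong₂ _+_ (sym (sumBelow-suc (n C_) (suc m))) (sym (sumBelow-suc (n C_) m)) ⟩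
  rowSum n (suc (suc m)) + rowSum n (suc m) ∎
  where open ≡-Reasoning

-- The candidate closed form R(k+s, min(s,k+1)) obeys the recurrence of
-- visitTotal-step.
rowSum-step : ∀ k s →
  rowSum (suc (k + s)) (suc s ⊓ suc k) + (rowSum (suc (k + s)) (s ⊓ suc (suc k)) + crossings (suc k) s)
    ≡ rowSum (suc (suc (k + s))) (suc s ⊓ suc (suc k))
rowSum-step k s with ℕP.<-cmp s (suc k)
... | tri< s<k+1 _ _ = begin
  rowSum n (suc s ⊓ suc k) + (rowSum n (s ⊓ suc (suc k)) + crossings (suc k) s)
    ≡⟨ cong₂ _+_ (cong (rowSum n) (ℕP.m≤n⇒m⊓n≡m s<k+1))
                 (cong₂ _+_ (cong (rowSum n) (ℕP.m≤n⇒m⊓n≡m (ℕP.m≤n⇒m≤1+n (ℕP.<⇒≤ s<k+1))))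
                            (crossings-off (suc k) s (ℕP.<⇒≢ s<k+1))) ⟩
  rowSum n (suc s) + (rowSum n s + 0)
    ≡⟨ cong (λ x → rowSum n (suc s) + x) (ℕP.+-identityʳ (rowSum n s)) ⟩
  rowSum n (suc s) + rowSum n s
    ≡⟨ sym (rowSum-pascal n s) ⟩
  rowSum (suc n) (suc s)
    ≡⟨ cong (rowSum (suc n)) (sym (ℕP.m≤n⇒m⊓n≡m (ℕP.m≤n⇒m≤1+n s<k+1))) ⟩
  rowSum (suc n) (suc s ⊓ suc (suc k)) ∎
  where
  open ≡-Reasoning
  n = suc (k + s)
... | tri≈ _ refl _ = begin
  rowSum n (suc (suc k) ⊓ suc k) + (rowSum n (suc k ⊓ suc (suc k)) + crossings (suc k) (suc k))
    ≡⟨ cong₂ _+_ (cong (rowSum n) (ℕP.m≥n⇒m⊓n≡n (ℕP.n≤1+n (suc k))))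
                 (cong₂ _+_ (cong (rowSum n) (ℕP.m≤n⇒m⊓n≡m (ℕP.n≤1+n (suc k))))
                            (crossings-diag (suc k))) ⟩
  rowSum n (suc k) + (rowSum n (suc k) + n C suc k)
    ≡⟨ cong (λ x → rowSum n (suc k) + x) (sym (sumBelow-suc (n C_) (suc k))) ⟩
  rowSum n (suc k) + rowSum n (suc (suc k))
    ≡⟨ ℕP.+-comm (rowSum n (suc k)) (rowSum n (suc (suc k))) ⟩
  rowSum n (suc (suc k)) + rowSum n (suc k)
    ≡⟨ sym (rowSum-pascal n (suc k)) ⟩
  rowSum (suc n) (suc (suc k))
    ≡⟨ cong (rowSum (suc n)) (sym (ℕP.⊓-idem (suc (suc k)))) ⟩
  rowSum (suc n) (suc (suc k) ⊓ suc (suc k)) ∎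
  where
  open ≡-Reasoning
  n = suc (k + suc k)
... | tri> _ _ k+1<s = begin
  rowSum n (suc s ⊓ suc k) + (rowSum n (s ⊓ suc (suc k)) + crossings (suc k) s)
    ≡⟨ cong₂ _+_ (cong (rowSum n) (ℕP.m≥n⇒m⊓n≡n (ℕP.m≤n⇒m≤1+n (ℕP.<⇒≤ k+1<s))))
                 (cong₂ _+_ (cong (rowSum n) (ℕP.m≥n⇒m⊓n≡n k+1<s))
                            (crossings-off (suc k) s (ℕP.>⇒≢ k+1<s))) ⟩
  rowSum n (suc k) + (rowSum n (suc (suc k)) + 0)
    ≡⟨ cong (λ x → rowSum n (suc k) + x) (ℕP.+-identityʳ (rowSum n (suc (suc k)))) ⟩
  rowSum n (suc k) + rowSum n (suc (suc k))
    ≡⟨ ℕP.+-comm (rowSum n (suc k)) (rowSum n (suc (suc k))) ⟩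
  rowSum n (suc (suc k)) + rowSum n (suc k)
    ≡⟨ sym (rowSum-pascal n (suc k)) ⟩
  rowSum (suc n) (suc (suc k))
    ≡⟨ cong (rowSum (suc n)) (sym (ℕP.m≥n⇒m⊓n≡n (ℕP.m≤n⇒m≤1+n k+1<s))) ⟩
  rowSum (suc n) (suc s ⊓ suc (suc k)) ∎
  where
  open ≡-Reasoning
  n = suc (k + s)

visitTotal-closed : ∀ k s → visitTotal k s ≡ rowSum (k + s) (s ⊓ suc k)
visitTotal-closed k       zero    = visitTotal-no-downs k
visitTotal-closed zero    (suc s) =
  trans (visitTotal-only-downs s) (cong (rowSum (suc s)) (sym (ℕP.m≥n⇒m⊓n≡n {suc s} {1} (s≤s z≤n))))
visitTotal-closed (suc k) (suc s) = begin
  visitTotal (suc k) (suc s)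
    ≡⟨ visitTotal-step k s ⟩
  visitTotal k (suc s) + (visitTotal (suc k) s + crossings (suc k) s)
    ≡⟨ cong₂ _+_ (trans (visitTotal-closed k (suc s)) (cong (λ n → rowSum n (suc s ⊓ suc k)) (ℕP.+-suc k s)))
                 (cong (λ t → t + crossings (suc k) s) (visitTotal-closed (suc k) s)) ⟩
  rowSum (suc (k + s)) (suc s ⊓ suc k) + (rowSum (suc (k + s)) (s ⊓ suc (suc k)) + crossings (suc k) s)
    ≡⟨ rowSum-step k s ⟩
  rowSum (suc (suc (k + s))) (suc s ⊓ suc (suc k))
    ≡⟨ cong (λ n → rowSum (suc n) (suc s ⊓ suc (suc k))) (sym (ℕP.+-suc k s)) ⟩
  rowSum (suc k + suc s) (suc s ⊓ suc (suc k)) ∎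
  where open ≡-Reasoning

uniformExpectation-≡ : ∀ {A : Set} (f : A → ℕ) (xs : List A) n t .{{_ : NonZero n}} →
  length xs ≡ n → sum (map f xs) ≡ t → uniformExpectation f xs ≡ (+ t) / n
uniformExpectation-≡ f []       n t length≡n _ = ⊥-elim (≢-nonZero⁻¹ n (sym length≡n))
uniformExpectation-≡ f (x ∷ xs) _ _ refl refl = refl

lemma3 : (k s : ℕ) → s ≤ k →
    uniformExpectation (visitsFromAbove -[1+ 0 ]) (paths k s)
    ≡ _/_ (+ sumBelow s (λ r → (k + s) C r)) ((k + s) C s) {{C-nonZero k s}}
lemma3 k s s≤k =
  uniformExpectation-≡ (visitsFromAbove -[1+ 0 ]) (paths k s) ((k + s) C s) (rowSum (k + s) s)
    {{C-nonZero k s}} (length-paths k s) total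
  where
  total : visitTotal k s ≡ rowSum (k + s) s
  total = trans (visitTotal-closed k s) (cong (rowSum (k + s)) (ℕP.m≤n⇒m⊓n≡m (ℕP.m≤n⇒m≤1+n s≤k)))
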